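{- There exist an expansion $\mathcal M$ of an ordered group, an $\mathcal M$-game $\mathcal A=(\mathcal M,Q,\mathrm{Goal},\Sigma,\delta,\gamma)$ and a partition $\mathcal P$ of $Q\times V_2$ such that $\mathrm{Goal}\times V_2$ is a union of pieces of $\mathcal P$ and the equivalence relation induced by $\mathcal P$ is a time-abstract bisimulation of the mixed transition system of $\mathcal A$, but the set of winning states of $\mathcal A$ (under perfect observation) is not a union of pieces of $\mathcal P$. In other words, a partition respecting $\mathrm{Goal}$ and inducing a time-abstract bisimulation on $Q\times V_2$ does not necessarily respect the set of winning states.
   Context: $\mathcal M=\langle M,+,0,1,<,\dots\rangle$ is an expansion of an ordered group with $0<1$; "definable" means first-order definable in $\mathcal M$; $M^+=\{\tau\in M\mid \tau\ge 0\}$. Fix sets $V_1\subseteq M^{k_1}$, $V\subseteq M$, $V_2\subseteq M^{k_2}$. An $\mathcal M$-automaton is a tuple $\mathcal A=(\mathcal M,Q,\mathrm{Goal},\Sigma,\delta,\gamma)$ where $Q$ is a finite set of locations, $\mathrm{Goal}\subseteq Q$, $\Sigma$ is a finite set of actions, $\delta$ is a finite set of transitions $(q,g,a,R,q')$ with $g\subseteq V_2$ definable and $R:V_2\to 2^{V_2}$ definable, and $\gamma$ maps each location $q$ to a definable function $\gamma_q:V_1\times V\to V_2$. An $\mathcal M$-game is an $\mathcal M$-automaton with $\Sigma=\Sigma_c\sqcup\Sigma_u$ (controllable / uncontrollable actions). The mixed transition system of $\mathcal A$ has states $Q\times V_2$, labels $M^+\cup\Sigma$, discrete transitions $(q,y)\xrightarrow{a}(q',y')$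 iff some $(q,g,a,R,q')\in\delta$ has $y\in g$, $y'\in R(y)$, and delay transitions $(q,y)\xrightarrow{\tau}(q,y')$ ($\tau\in M^+$) iff there are $x\in V_1$, $t_1\le t_2$ in $M^+$ with $\gamma_q(x,t_1)=y$, $\gamma_q(x,t_2)=y'$, $\tau=t_2-t_1$. We write $(q,y)\xrightarrow{\tau}_{x,t}(q,y')$ iff $\gamma_q(x,t)=y$, $\gamma_q(x,t+\tau)=y'$, also $(q,x,t,y)\xrightarrow{\tau}(q,x,t+\tau,y')$; and $(q,x,t,y)\xrightarrow{\tau,a}(q'',x'',t'',y'')$ if $(q,x,t,y)\xrightarrow{\tau}(q,x,t+\tau,y')$, $(q,y')\xrightarrow{a}(q'',y'')$ and $\gamma_{q''}(x'',t'')=y''$ ($(\tau,a)$ is then enabled in $(q,x,t,y)$). A time-abstract bisimulation is an equivalence $\sim$ on states such that if $s_1\sim s_1'$ and $s_1\xrightarrow{a}s_2$ ($a\in\Sigma$) then $s_1'\xrightarrow{a}s_2'$ for some $s_2'\sim s_2$, and if $s_1\sim s_1'$ and $s_1\xrightarrow{\tau}s_2$ ($\tau\in M^+$) then $s_1'\xrightarrow{\tau'}s_2'$ for some $\tau'\in M^+$ and $s_2'\sim s_2$. Runs are sequences $(q_0,x_0,t_0,y_0)\xrightarrow{\tau_1,a_1}(q_1,x_1,t_1,y_1)\cdots$, winning if some $q_i\in\mathrm{Goal}$. A strategy is a partial map $\lambda$ from finite runs to $M^+\times\Sigma_c$ whose value, when defined, is enabled in the last state. A run is consistent with $\lambda$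 if for each prefix $\rho_i$ with $\lambda(\rho_i)=(\tau,a)$, either $(\tau_{i+1},a_{i+1})=(\tau,a)$ or $\tau_{i+1}\le\tau$ and $a_{i+1}\in\Sigma_u$; maximal if infinite or $\lambda$ undefined on it. $\lambda$ is winning from $(q,y)$ if for all $(x,t)$ with $\gamma_q(x,t)=y$ every maximal consistent run from $(q,x,t,y)$ is winning; $(q,y)$ is a winning state if some strategy is winning from it. -}

module Defs where

open import Data.Nat using (ℕ; zero; suc; _+_) renaming (_<_ to _<ℕ_; _≤_ to _≤ℕ_)
open import Data.Fin using (Fin)
open import Data.Fin.Subset using (Subset) renaming (_∈_ to _∈ₛ_)
open import Data.Vec using (Vec; []; _∷_; lookup; _++_) renaming (map to vmap)
open import Data.List using (List; []; _∷_; upTo; length) renaming (map to lmap)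
import Data.List as List
open import Data.Maybe using (Maybe; just; nothing)
open import Data.Product using (Σ; _×_; _,_; proj₁; proj₂)
open import Data.Sum using (_⊎_; inj₁; inj₂)
open import Data.Unit using (⊤)
open import Data.Empty using (⊥)
open import Relation.Nullary using (¬_)
open import Relation.Binary.PropositionalEquality using (_≡_)
open import Algebra.Structures using (IsAbelianGroup)
open import Relation.Binary.Structures using (IsStrictTotalOrder)

record OrderedGroup : Set₁ where
  field
    Carrier : Set
    _+ᴹ_ : Carrier → Carrier → Carrier
    0ᴹ : Carrier
    1ᴹ : Carrier
    -ᴹ_ : Carrier → Carrier
    _<ᴹ_ : Carrier → Carrier → Set
    isAbelianGroup : IsAbelianGroup _≡_ _+ᴹ_ 0ᴹ -ᴹ_
    isStrictTotalOrder : IsStrictTotalOrder _≡_ _<ᴹ_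
    +-mono-< : ∀ {x y} z → x <ᴹ y → (z +ᴹ x) <ᴹ (z +ᴹ y)
    0<1 : 0ᴹ <ᴹ 1ᴹ

  _≤ᴹ_ : Carrier → Carrier → Set
  x ≤ᴹ y = (x <ᴹ y) ⊎ (x ≡ y)

  _-ᴹ_ : Carrier → Carrier → Carrier
  x -ᴹ y = x +ᴹ (-ᴹ y)

record Expansion : Set₁ where
  field
    group : OrderedGroup
    Sym : Set
    arity : Sym → ℕ
    interp : (r : Sym) → Vec (OrderedGroup.Carrier group) (arity r) → Set
  open OrderedGroup group public

module Syntax (𝓜 : Expansion) where
  open Expansion 𝓜

  data Term (n : ℕ) : Set where
    var : Fin n → Term n
    par : Carrier → Term n
    zeroT : Term n
    oneT : Term n
    _⊕_ : Term n → Term n → Term n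
    ⊖_ : Term n → Term n

  data Formula (n : ℕ) : Set where
    trueF : Formula n
    falseF : Formula n
    _≐_ : Term n → Term n → Formula n
    _≺_ : Term n → Term n → Formula n
    rel : (r : Sym) → Vec (Term n) (arity r) → Formula n
    notF : Formula n → Formula n
    _∧F_ : Formula n → Formula n → Formula n
    _∨F_ : Formula n → Formula n → Formula n
    _⇒F_ : Formula n → Formula n → Formula n
    existsF : Formula (suc n) → Formula n
    forallF : Formula (suc n) → Formula n

  evalT : ∀ {n} → Vec Carrier n → Term n → Carrier
  evalT ρ (var i) = lookup ρ i
  evalT ρ (par c) = c
  evalT ρ zeroT = 0ᴹ
  evalT ρ oneT = 1ᴹ
  evalT ρ (s ⊕ t) = evalT ρ s +ᴹ evalT ρ t
  evalT ρ (⊖ t) = -ᴹ evalT ρ t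

  sat : ∀ {n} → Formula n → Vec Carrier n → Set
  sat trueF ρ = ⊤
  sat falseF ρ = ⊥
  sat (s ≐ t) ρ = evalT ρ s ≡ evalT ρ t
  sat (s ≺ t) ρ = evalT ρ s <ᴹ evalT ρ t
  sat (rel r ts) ρ = interp r (vmap (evalT ρ) ts)
  sat (notF φ) ρ = ¬ sat φ ρ
  sat (φ ∧F ψ) ρ = sat φ ρ × sat ψ ρ
  sat (φ ∨F ψ) ρ = sat φ ρ ⊎ sat ψ ρ
  sat (φ ⇒F ψ) ρ = sat φ ρ → sat ψ ρ
  sat (existsF φ) ρ = Σ Carrier λ a → sat φ (a ∷ ρ)
  sat (forallF φ) ρ = (a : Carrier) → sat φ (a ∷ ρ)

  Definable : (k : ℕ) → (Vec Carrier k → Set) → Set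
  Definable k S = Σ (Formula k) λ φ → (v : Vec Carrier k) → (S v → sat φ v) × (sat φ v → S v)

record Domains (𝓜 : Expansion) : Set₁ where
  open Expansion 𝓜
  open Syntax 𝓜
  field
    k₁ : ℕ
    k₂ : ℕ
    V₁ : Vec Carrier k₁ → Set
    V : Carrier → Set
    V₂ : Vec Carrier k₂ → Set
    V₁-def : Definable k₁ V₁
    V-def : Definable 1 (λ v → Σ Carrier λ t → (v ≡ t ∷ []) × V t)
    V₂-def : Definable k₂ V₂

module GameRec (𝓜 : Expansion) (D : Domains 𝓜) where
  open Expansion 𝓜
  open Syntax 𝓜
  open Domains D

  -- Actions: controllable (Fin nC) ⊎ uncontrollable (Fin nU).
  record Transition (nQ nC nU : ℕ) : Set₁ where
    field
      src : Fin nQ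
      guard : Vec Carrier k₂ → Set
      guard-def : Definable k₂ guard
      guard⊆V₂ : ∀ y → guard y → V₂ y
      act : Fin nC ⊎ Fin nU
      -- the reset R : V₂ → 2^V₂, given by its graph
      reset : Vec Carrier k₂ → Vec Carrier k₂ → Set
      reset-def : Definable (k₂ + k₂)
                    (λ v → Σ (Vec Carrier k₂) λ y → Σ (Vec Carrier k₂) λ y' → (v ≡ y ++ y') × reset y y')
      reset⊆V₂ : ∀ y y' → reset y y' → V₂ y × V₂ y'
      tgt : Fin nQ

  record Game : Set₁ where
    field
      nQ : ℕ
      Goal : Subset nQ
      nC : ℕ
      nU : ℕ
      δ : List (Transition nQ nC nU)
      γ : Fin nQ → Vec Carrier k₁ → Carrier → Vec Carrier k₂
      γ-def : (q : Fin nQ) → Definable (k₁ + suc k₂)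
                (λ v → Σ (Vec Carrier k₁) λ x → Σ Carrier λ t → Σ (Vec Carrier k₂) λ y →
                         (v ≡ x ++ (t ∷ y)) × V₁ x × V t × (γ q x t ≡ y))
      γ-into : ∀ q x t → V₁ x → V t → V₂ (γ q x t)

module GameSem {𝓜 : Expansion} {D : Domains 𝓜} (A : GameRec.Game 𝓜 D) where
  open Expansion 𝓜
  open Domains D
  open GameRec 𝓜 D
  open Game A

  Action : Set
  Action = Fin nC ⊎ Fin nU

  -- ambient type of pairs (q , y); the states are those with y ∈ V₂
  Pair : Set
  Pair = Fin nQ × Vec Carrier k₂

  StateSet : Pair → Set
  StateSet (q , y) = V₂ y

  GoalSet : Pair → Set
  GoalSet (q , y) = (q ∈ₛ Goal) × V₂ y

  Disc : Pair → Action → Pair → Set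
  Disc (q , y) a (q' , y') =
    Σ (Fin (length δ)) λ i → let tr = List.lookup δ i in
      (Transition.src tr ≡ q) × (Transition.act tr ≡ a) × (Transition.tgt tr ≡ q') ×
      Transition.guard tr y × Transition.reset tr y y'

  Delay : Pair → Carrier → Pair → Set
  Delay (q , y) τ (q' , y') =
    (q ≡ q') × Σ (Vec Carrier k₁) λ x → Σ Carrier λ t₁ → Σ Carrier λ t₂ →
      V₁ x × V t₁ × V t₂ × (0ᴹ ≤ᴹ t₁) × (0ᴹ ≤ᴹ t₂) × (t₁ ≤ᴹ t₂) ×
      (γ q x t₁ ≡ y) × (γ q x t₂ ≡ y') × (τ ≡ t₂ -ᴹ t₁)

  IsTimeAbstractBisimulation : (Pair → Pair → Set) → Set
  IsTimeAbstractBisimulation _~_ =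
    (∀ s₁ s₁' s₂ a → s₁ ~ s₁' → Disc s₁ a s₂ →
       Σ Pair λ s₂' → Disc s₁' a s₂' × (s₂' ~ s₂)) ×
    (∀ s₁ s₁' s₂ τ → s₁ ~ s₁' → (0ᴹ ≤ᴹ τ) → Delay s₁ τ s₂ →
       Σ Carrier λ τ' → Σ Pair λ s₂' → (0ᴹ ≤ᴹ τ') × Delay s₁' τ' s₂' × (s₂' ~ s₂))

  ExtState : Set
  ExtState = Fin nQ × Vec Carrier k₁ × Carrier × Vec Carrier k₂

  Label : Set
  Label = Carrier × Action

  Consistent : ExtState → Set
  Consistent (q , x , t , y) = V₁ x × V t × (γ q x t ≡ y)

  Step : ExtState → Label → ExtState → Set
  Step (q , x , t , y) (τ , a) (q'' , x'' , t'' , y'') =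
    (0ᴹ ≤ᴹ τ) × Consistent (q , x , t , y) × V (t +ᴹ τ) ×
    Σ (Vec Carrier k₂) λ y' → (γ q x (t +ᴹ τ) ≡ y') ×
      Disc (q , y') a (q'' , y'') × Consistent (q'' , x'' , t'' , y'')

  Enabled : ExtState → Label → Set
  Enabled e l = Σ ExtState λ e'' → Step e l e''

  RawRun : Set
  RawRun = ExtState × List (Label × ExtState)

  lastState : ExtState → List (Label × ExtState) → ExtState
  lastState e [] = e
  lastState e ((l , e') ∷ rest) = lastState e' rest

  ValidChain : ExtState → List (Label × ExtState) → Set
  ValidChain e [] = ⊤
  ValidChain e ((l , e') ∷ rest) = Step e l e' × ValidChain e' rest

  IsFiniteRun : RawRun → Set
  IsFiniteRun (e₀ , steps) = Consistent e₀ × ValidChain e₀ steps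

  record Strategy : Set where
    field
      σ : RawRun → Maybe (Carrier × Fin nC)
      σ-ok : ∀ e₀ steps τ c → IsFiniteRun (e₀ , steps) → σ (e₀ , steps) ≡ just (τ , c) →
             (0ᴹ ≤ᴹ τ) × Enabled (lastState e₀ steps) (τ , inj₁ c)

  -- comparison of a natural number with a possibly infinite length
  _<ᴸ_ : ℕ → Maybe ℕ → Set
  i <ᴸ nothing = ⊤
  i <ᴸ just n = i <ℕ n

  _≤ᴸ_ : ℕ → Maybe ℕ → Set
  i ≤ᴸ nothing = ⊤
  i ≤ᴸ just n = i ≤ℕ n

  -- runs (finite, of length n = number of steps, or infinite)
  record Run : Set where
    field
      len : Maybe ℕ
      st : ℕ → ExtState
      lab : ℕ → Label
      st₀-ok : Consistent (st 0)
      steps-ok : ∀ i → i <ᴸ len → Step (st i) (lab i) (st (suc i))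

    prefix : ℕ → RawRun
    prefix i = st 0 , lmap (λ j → lab j , st (suc j)) (upTo i)

  module _ (S : Strategy) (r : Run) where
    open Strategy S
    open Run r

    ConsistentWith : Set
    ConsistentWith = ∀ i → i <ᴸ len → ∀ τ c → σ (prefix i) ≡ just (τ , c) →
      (lab i ≡ (τ , inj₁ c)) ⊎ ((proj₁ (lab i) ≤ᴹ τ) × Σ (Fin nU) λ u → proj₂ (lab i) ≡ inj₂ u)

    Maximal : Set
    Maximal = (len ≡ nothing) ⊎ Σ ℕ λ n → (len ≡ just n) × (σ (prefix n) ≡ nothing)

  WinningRun : Run → Set
  WinningRun r = Σ ℕ λ i → (i ≤ᴸ Run.len r) × (proj₁ (Run.st r i) ∈ₛ Goal)

  WinningFrom : Strategy → Pair → Set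
  WinningFrom S (q , y) =
    ∀ x t → V₁ x → V t → γ q x t ≡ y →
    ∀ (r : Run) → Run.st r 0 ≡ (q , x , t , y) → ConsistentWith S r → Maximal S r → WinningRun r

  WinningSet : Pair → Set
  WinningSet s = StateSet s × Σ Strategy λ S → WinningFrom S s

record Partition {X : Set} (S : X → Set) : Set₁ where
  field
    Index : Set
    piece : Index → X → Set
    piece⊆ : ∀ i x → piece i x → S x
    nonempty : ∀ i → Σ X (piece i)
    disjoint : ∀ {i j x} → piece i x → piece j x → i ≡ j
    cover : ∀ x → S x → Σ Index λ i → piece i x

module _ {X : Set} {S : X → Set} (P : Partition S) where
  open Partition P

  UnionOfPieces : (X → Set) → Set₁
  UnionOfPieces T = Σ (Index → Set) λ J →
    ∀ x → (T x → Σ Index λ i → J i × piece i x) × (Σ Index (λ i → J i × piece i x) → T x)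

  InducedEquiv : X → X → Set
  InducedEquiv x x' = Σ Index λ i → piece i x × piece i x'

module Submission where

-- Counterexample over (ℤ, +, 0, 1, <).  Take V₁ = {0, 2}, V = {0, 1, 2},
-- V₂ = {1, 2, 3} and two locations q₀ (not a goal) and q₁ (a goal), with the
-- same dynamics in both: the parameter x = 2 drains the value y = 3 - t from 3
-- down to 1, while x = 0 keeps y = 3 for ever.  One controllable transition
-- leads from q₀ to q₁ and is guarded by y = 1.  The partition has the blocks
-- {(q₀,1)}, {(q₀,2),(q₀,3)} and {q₁} × V₂.  It is a time-abstract
-- bisimulation because every state lies on the draining trajectory, so it can
-- idle in its block or delay into (q₀,1).  But (q₀,2) is winning (its only
-- trajectory drains, so wait one time unit and fire), while (q₀,3) is not (on
-- the trajectory x = 0 the guard is never reached).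

open import Defs
open import Data.Product using (Σ; _×_; _,_; proj₁; proj₂)
open import Relation.Nullary using (¬_)

open import Data.Nat using (z≤n; s≤s) renaming (suc to 1+; _≤_ to _≤ℕ_)
import Data.Nat.Properties as ℕP
open import Data.Integer using (ℤ; +_; _-_; +<+) renaming (_+_ to _+ℤ_; _<_ to _<ℤ_)
import Data.Integer as ℤ
import Data.Integer.Properties as ℤP
open import Data.Fin using (Fin; zero; suc)
import Data.Fin as Fin
open import Data.Fin.Subset using () renaming (_∈_ to _∈ₛ_)
open import Data.Vec using (Vec; []; _∷_; here; there)
import Data.List as List
open import Data.List using ([]; _∷_)
open import Data.Maybe using (Maybe; just; nothing)
open import Data.Sum using (_⊎_; inj₁; inj₂)
import Data.Sum as Sum
open import Data.Unit using (tt)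
open import Data.Empty using (⊥; ⊥-elim)
open import Data.Bool using (Bool; true; false; if_then_else_)
open import Relation.Nullary using (yes; no)
open import Relation.Nullary.Decidable using (_×-dec_)
open import Relation.Binary.PropositionalEquality
  using (_≡_; _≢_; refl; sym; trans; cong; subst; subst₂)
open import Algebra.Structures using (IsAbelianGroup)

-- In an ordered group, the duration t₂ - t₁ of a delay with t₁ ≤ t₂ is
-- nonnegative; this is what makes every trajectory segment a delay transition.
module OrderedGroupFacts (G : OrderedGroup) where
  open OrderedGroup G
  open IsAbelianGroup isAbelianGroup using (inverseˡ; inverseʳ; comm)

  duration-nonneg : ∀ {t₁ t₂} → t₁ ≤ᴹ t₂ → 0ᴹ ≤ᴹ (t₂ -ᴹ t₁)
  duration-nonneg {t₁} {t₂} (inj₁ t₁<t₂) =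
    inj₁ (subst₂ _<ᴹ_ (inverseˡ t₁) (comm (-ᴹ t₁) t₂) (+-mono-< (-ᴹ t₁) t₁<t₂))
  duration-nonneg {t₁} (inj₂ refl) = inj₂ (sym (inverseʳ t₁))

module ClassPartition {X I : Set} (S : X → Set) (cls : X → I) where

  Fibre : I → X → Set
  Fibre i x = S x × (cls x ≡ i)

  partitionBy : (∀ i → Σ X (Fibre i)) → Partition S
  partitionBy inhabited = record
    { Index = I ; piece = Fibre ; piece⊆ = λ _ _ → proj₁ ; nonempty = inhabited
    ; disjoint = λ (_ , p) (_ , q) → trans (sym p) q
    ; cover = λ x Sx → cls x , Sx , refl }

  module Induced (inhabited : ∀ i → Σ X (Fibre i)) where
    private P = partitionBy inhabited

    same-class-equiv : ∀ x x' → S x → S x' → cls x ≡ cls x' → InducedEquiv P x x'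
    same-class-equiv x x' Sx Sx' eq = cls x' , (Sx , eq) , (Sx' , refl)

    equiv-same-class : ∀ x x' → InducedEquiv P x x' → S x × S x' × (cls x ≡ cls x')
    equiv-same-class x x' (_ , (Sx , p) , (Sx' , q)) = Sx , Sx' , trans p (sym q)

    union-of-classes : (T : X → Set) (J : I → Set) →
      (∀ x → T x → S x × J (cls x)) → (∀ x → S x → J (cls x) → T x) →
      UnionOfPieces P T
    union-of-classes T J T⇒J J⇒T = J , λ x →
      (λ Tx → let (Sx , Jx) = T⇒J x Tx in cls x , Jx , Sx , refl) ,
      (λ (_ , Ji , Sx , eq) → J⇒T x Sx (subst J (sym eq) Ji))

union-respects-equiv : ∀ {X : Set} {S : X → Set} (P : Partition S) {T : X → Set} →
  UnionOfPieces P T → ∀ {x x'} → InducedEquiv P x x' → T x → T x'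
union-respects-equiv P (J , h) {x} {x'} (j , pjx , pjx') Tx
  with proj₁ (h x) Tx
... | i , Ji , pix = proj₂ (h x') (j , subst J (Partition.disjoint P pix pjx) Ji , pjx')

module GameFacts {𝓜 : Expansion} {D : Domains 𝓜} (A : GameRec.Game 𝓜 D) where
  open Expansion 𝓜
  open Domains D
  open GameRec 𝓜 D
  open Game A
  open GameSem A
  open OrderedGroupFacts group

  _⇝_ : Pair → Pair → Set
  s ⇝ s' = Σ Carrier λ τ → (0ᴹ ≤ᴹ τ) × Delay s τ s'

  flow : ∀ q {x t₁ t₂} → V₁ x → V t₁ → V t₂ → 0ᴹ ≤ᴹ t₁ → 0ᴹ ≤ᴹ t₂ → t₁ ≤ᴹ t₂ →
         (q , γ q x t₁) ⇝ (q , γ q x t₂)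
  flow q {x} {t₁} {t₂} x∈V₁ t₁∈V t₂∈V 0≤t₁ 0≤t₂ t₁≤t₂ =
    t₂ -ᴹ t₁ , duration-nonneg t₁≤t₂ ,
    refl , x , t₁ , t₂ , x∈V₁ , t₁∈V , t₂∈V , 0≤t₁ , 0≤t₂ , t₁≤t₂ , refl , refl , refl

  delay-location : ∀ s τ s' → Delay s τ s' → proj₁ s ≡ proj₁ s'
  delay-location (q , y) τ (q' , y') d = proj₁ d

  delay-target : ∀ s τ s' → Delay s τ s' → StateSet s'
  delay-target (q , y) τ (q' , y') (_ , x , _ , t₂ , x∈V₁ , _ , t₂∈V , _ , _ , _ , _ , γ≡y' , _) =
    subst V₂ γ≡y' (γ-into q x t₂ x∈V₁ t₂∈V)

  disc-target : ∀ s a s' → Disc s a s' → StateSet s'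
  disc-target (q , y) a (q' , y') (i , _ , _ , _ , _ , r) =
    proj₂ (Transition.reset⊆V₂ (List.lookup δ i) y y' r)

  TransitionsEnterGoal : Set
  TransitionsEnterGoal = ∀ i → Transition.tgt (List.lookup δ i) ∈ₛ Goal

  step-enters-goal : TransitionsEnterGoal → ∀ e l e' → Step e l e' → proj₁ e' ∈ₛ Goal
  step-enters-goal enter (q , x , t , y) (τ , a) (q' , x' , t' , y')
    (_ , _ , _ , _ , _ , (i , _ , _ , tgt≡q' , _) , _) = subst (_∈ₛ Goal) tgt≡q' (enter i)

  won-after-first-step : TransitionsEnterGoal → (r : Run) → 0 <ᴸ Run.len r → WinningRun r
  won-after-first-step enter r 0<len =
    1 , first-step-bound (Run.len r) 0<len ,
    step-enters-goal enter _ _ _ (Run.steps-ok r 0 0<len)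
    where
    first-step-bound : ∀ l → 0 <ᴸ l → 1 ≤ᴸ l
    first-step-bound nothing _ = tt
    first-step-bound (just n) 0<n = 0<n

  maximal-moves : (S : Strategy) (r : Run) → Maximal S r →
    Strategy.σ S (Run.prefix r 0) ≢ nothing → 0 <ᴸ Run.len r
  maximal-moves S r (inj₁ len≡∞) _ = subst (0 <ᴸ_) (sym len≡∞) tt
  maximal-moves S r (inj₂ (0 , _ , stops)) moves = ⊥-elim (moves stops)
  maximal-moves S r (inj₂ (1+ n , len≡n , _)) _ = subst (0 <ᴸ_) (sym len≡n) (s≤s z≤n)

  Stuck : ExtState → Set
  Stuck e = ∀ τ c → ¬ Enabled e (τ , inj₁ c)

  -- A non-goal state that some consistent extended state leaves stuck is
  -- losing: against every strategy the run staying there is maximal.  (Runs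
  -- carry a label at every index, so an action fills the unused positions.)
  stuck-losing : Action → ∀ {q x t y} → Consistent (q , x , t , y) → Stuck (q , x , t , y) →
    ¬ (q ∈ₛ Goal) → ¬ WinningSet (q , y)
  stuck-losing a {q} {x} {t} {y} e-ok stuck q∉Goal (_ , S , winning) =
    q∉Goal (proj₂ (proj₂ (winning x t x∈V₁ t∈V γ≡y r refl (λ _ ()) maximal)))
    where
    open Strategy S
    e : ExtState
    e = q , x , t , y
    x∈V₁ : V₁ x
    x∈V₁ = proj₁ e-ok
    t∈V : V t
    t∈V = proj₁ (proj₂ e-ok)
    γ≡y : γ q x t ≡ y
    γ≡y = proj₂ (proj₂ e-ok)
    r : Run
    r = record { len = just 0 ; st = λ _ → e ; lab = λ _ → 0ᴹ , a
               ; st₀-ok = e-ok ; steps-ok = λ _ () }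
    no-move : σ (e , []) ≡ nothing
    no-move with σ (e , []) in eq
    ... | nothing = refl
    ... | just (τ , c) = ⊥-elim (stuck τ c (proj₂ (σ-ok e [] τ c (e-ok , tt) eq)))
    maximal : Maximal S r
    maximal = inj₂ (0 , refl , no-move)

ℤ-ordered : OrderedGroup
ℤ-ordered = record
  { Carrier = ℤ ; _+ᴹ_ = _+ℤ_ ; 0ᴹ = + 0 ; 1ᴹ = + 1 ; -ᴹ_ = ℤ.-_ ; _<ᴹ_ = _<ℤ_
  ; isAbelianGroup = ℤP.+-0-isAbelianGroup
  ; isStrictTotalOrder = ℤP.<-isStrictTotalOrder
  ; +-mono-< = λ z → ℤP.+-monoʳ-< z
  ; 0<1 = +<+ (s≤s z≤n) }

𝓜ℤ : Expansion
𝓜ℤ = record { group = ℤ-ordered ; Sym = ⊥ ; arity = λ () ; interp = λ () }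

open Syntax 𝓜ℤ
open OrderedGroup ℤ-ordered using (0ᴹ; _≤ᴹ_)

+≤+ : ∀ {m n} → m ≤ℕ n → (+ m) ≤ᴹ (+ n)
+≤+ m≤n = Sum.map +<+ (cong +_) (ℕP.m≤n⇒m<n∨m≡n m≤n)

V₁ℤ : Vec ℤ 1 → Set
V₁ℤ (x ∷ []) = (x ≡ + 0) ⊎ (x ≡ + 2)

Vℤ : ℤ → Set
Vℤ t = (t ≡ + 0) ⊎ ((t ≡ + 1) ⊎ (t ≡ + 2))

V₂ℤ : Vec ℤ 1 → Set
V₂ℤ (y ∷ []) = (y ≡ + 1) ⊎ ((y ≡ + 2) ⊎ (y ≡ + 3))

Vℤ-formula : ∀ {n} → Term n → Formula n
Vℤ-formula s = (s ≐ par (+ 0)) ∨F ((s ≐ par (+ 1)) ∨F (s ≐ par (+ 2)))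

Dℤ : Domains 𝓜ℤ
Dℤ = record
  { k₁ = 1 ; k₂ = 1 ; V₁ = V₁ℤ ; V = Vℤ ; V₂ = V₂ℤ
  ; V₁-def = ((var zero ≐ par (+ 0)) ∨F (var zero ≐ par (+ 2))) ,
             λ { (x ∷ []) → (λ p → p) , (λ p → p) }
  ; V-def = Vℤ-formula (var zero) ,
            λ { (a ∷ []) → (λ { (t , refl , p) → p }) , (λ p → a , refl , p) }
  ; V₂-def = ((var zero ≐ par (+ 1)) ∨F ((var zero ≐ par (+ 2)) ∨F (var zero ≐ par (+ 3)))) ,
             λ { (y ∷ []) → (λ p → p) , (λ p → p) }
  }

open GameRec 𝓜ℤ Dℤ

level : ℤ → ℤ → ℤ
level (+ 2) t = + 3 - t
level x t = + 3

γℤ : Fin 2 → Vec ℤ 1 → ℤ → Vec ℤ 1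
γℤ q (x ∷ []) t = level x t ∷ []

-- The graph of γ, with the variables ordered (x, t, y).
γℤ-formula : Formula 3
γℤ-formula = Vℤ-formula (var (suc zero)) ∧F
  (((var zero ≐ par (+ 2)) ∧F (var (suc (suc zero)) ≐ (par (+ 3) ⊕ (⊖ var (suc zero)))))
   ∨F ((var zero ≐ par (+ 0)) ∧F (var (suc (suc zero)) ≐ par (+ 3))))

γℤ-into : ∀ (q : Fin 2) x t → V₁ℤ x → Vℤ t → V₂ℤ (γℤ q x t)
γℤ-into q (_ ∷ []) t (inj₁ refl) _ = inj₂ (inj₂ refl)
γℤ-into q (_ ∷ []) _ (inj₂ refl) (inj₁ refl) = inj₂ (inj₂ refl)
γℤ-into q (_ ∷ []) _ (inj₂ refl) (inj₂ (inj₁ refl)) = inj₂ (inj₁ refl)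
γℤ-into q (_ ∷ []) _ (inj₂ refl) (inj₂ (inj₂ refl)) = inj₁ refl

fire : Transition 2 1 0
fire = record
  { src = zero
  ; guard = λ { (y ∷ []) → y ≡ + 1 }
  ; guard-def = (var zero ≐ par (+ 1)) , λ { (y ∷ []) → (λ p → p) , (λ p → p) }
  ; guard⊆V₂ = λ { (y ∷ []) y≡1 → inj₁ y≡1 }
  ; act = inj₁ zero
  ; reset = λ { (y ∷ []) (y' ∷ []) → (y ≡ + 1) × (y' ≡ + 1) }
  ; reset-def = ((var zero ≐ par (+ 1)) ∧F (var (suc zero) ≐ par (+ 1))) ,
      λ { (a ∷ b ∷ []) → (λ { ((y ∷ []) , (y' ∷ []) , refl , p) → p })
                        , (λ p → (a ∷ []) , (b ∷ []) , refl , p) }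
  ; reset⊆V₂ = λ { (y ∷ []) (y' ∷ []) (y≡1 , y'≡1) → inj₁ y≡1 , inj₁ y'≡1 }
  ; tgt = suc zero
  }

game : Game
game = record
  { nQ = 2 ; Goal = false ∷ true ∷ [] ; nC = 1 ; nU = 0
  ; δ = fire ∷ []
  ; γ = γℤ
  ; γ-def = λ q → γℤ-formula , λ
      { (a ∷ b ∷ c ∷ []) →
          (λ { ((_ ∷ []) , t , (y ∷ []) , refl , inj₁ refl , t∈V , refl) → t∈V , inj₂ (refl , refl)
             ; ((_ ∷ []) , t , (y ∷ []) , refl , inj₂ refl , t∈V , refl) → t∈V , inj₁ (refl , refl) })
        , (λ { (t∈V , inj₁ (refl , refl)) → (+ 2 ∷ []) , b , (c ∷ []) , refl , inj₂ refl , t∈V , refl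
             ; (t∈V , inj₂ (refl , refl)) → (+ 0 ∷ []) , b , (c ∷ []) , refl , inj₁ refl , t∈V , refl }) }
  ; γ-into = γℤ-into
  }

open GameSem game
open GameFacts game

drain : ∀ {y} → V₂ℤ (y ∷ []) →
  Σ ℤ λ t → Vℤ t × ((+ 0) ≤ᴹ t) × (t ≤ᴹ (+ 2)) × (level (+ 2) t ≡ y)
drain (inj₁ refl) = + 2 , inj₂ (inj₂ refl) , +≤+ z≤n , inj₂ refl , refl
drain (inj₂ (inj₁ refl)) = + 1 , inj₂ (inj₁ refl) , +≤+ z≤n , +≤+ (s≤s z≤n) , refl
drain (inj₂ (inj₂ refl)) = + 0 , inj₁ refl , inj₂ refl , +≤+ z≤n , refl

idle : ∀ q {y} → V₂ℤ (y ∷ []) → (q , y ∷ []) ⇝ (q , y ∷ [])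
idle q y∈V₂ with drain y∈V₂
... | t , t∈V , 0≤t , _ , refl = flow q (inj₂ refl) t∈V t∈V 0≤t 0≤t (inj₂ refl)

reach-guard : ∀ q {y} → V₂ℤ (y ∷ []) → (q , y ∷ []) ⇝ (q , + 1 ∷ [])
reach-guard q y∈V₂ with drain y∈V₂
... | t , t∈V , 0≤t , t≤2 , refl =
  flow q (inj₂ refl) t∈V (inj₂ (inj₂ refl)) 0≤t (+≤+ z≤n) t≤2

data Block : Set where
  guardBlock waitBlock goalBlock : Block

isOne : ℤ → Bool
isOne (+ 1) = true
isOne _ = false

block : Pair → Block
block (zero , y ∷ []) = if isOne y then guardBlock else waitBlock
block (suc _ , _) = goalBlock

guardState : Pair
guardState = zero , + 1 ∷ []

open ClassPartition StateSet block using (Fibre; partitionBy)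

blocks-inhabited : ∀ b → Σ Pair (Fibre b)
blocks-inhabited guardBlock = guardState , inj₁ refl , refl
blocks-inhabited waitBlock = (zero , + 2 ∷ []) , inj₂ (inj₁ refl) , refl
blocks-inhabited goalBlock = (suc zero , + 1 ∷ []) , inj₁ refl , refl

partition : Partition StateSet
partition = partitionBy blocks-inhabited

open ClassPartition.Induced StateSet block blocks-inhabited

_~_ : Pair → Pair → Set
_~_ = InducedEquiv partition

start-blocks : ∀ y → (block (zero , y ∷ []) ≡ guardBlock) ⊎ (block (zero , y ∷ []) ≡ waitBlock)
start-blocks y with isOne y
... | true = inj₁ refl
... | false = inj₂ refl

start-not-goal : ∀ y → block (zero , y ∷ []) ≢ goalBlock
start-not-goal y with isOne y
... | true = λ ()
... | false = λ ()

same-block-location : ∀ s s' → block s ≡ block s' → proj₁ s ≡ proj₁ s'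
same-block-location (zero , _) (zero , _) _ = refl
same-block-location (suc zero , _) (suc zero , _) _ = refl
same-block-location (zero , y ∷ []) (suc zero , _) eq = ⊥-elim (start-not-goal y eq)
same-block-location (suc zero , _) (zero , y ∷ []) eq = ⊥-elim (start-not-goal y (sym eq))

guard-singleton : ∀ s → StateSet s → block s ≡ guardBlock → s ≡ guardState
guard-singleton (zero , _ ∷ []) (inj₁ refl) _ = refl
guard-singleton (zero , _ ∷ []) (inj₂ (inj₁ refl)) ()
guard-singleton (zero , _ ∷ []) (inj₂ (inj₂ refl)) ()
guard-singleton (suc _ , _) _ ()

guard-alone : ∀ s s' → s ~ s' → s ≡ guardState → s' ≡ s
guard-alone s s' s~s' refl with equiv-same-class s s' s~s'
... | _ , s'-ok , same = guard-singleton s' s'-ok (sym same)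

same-location-blocks : ∀ s s' → proj₁ s ≡ proj₁ s' →
  (block s' ≡ block s) ⊎ ((block s ≡ guardBlock) ⊎ (block s' ≡ guardBlock))
same-location-blocks (suc _ , _) (suc _ , _) _ = inj₁ refl
same-location-blocks (zero , y ∷ []) (zero , y' ∷ []) _ with start-blocks y | start-blocks y'
... | inj₁ guard | _ = inj₂ (inj₁ guard)
... | inj₂ _ | inj₁ guard' = inj₂ (inj₂ guard')
... | inj₂ wait | inj₂ wait' = inj₁ (trans wait' (sym wait))

goal-union : UnionOfPieces partition GoalSet
goal-union = union-of-classes GoalSet (_≡ goalBlock) goal⇒block block⇒goal
  where
  goal⇒block : ∀ s → GoalSet s → StateSet s × (block s ≡ goalBlock)
  goal⇒block (zero , _) (() , _)
  goal⇒block (suc zero , _) (_ , y∈V₂) = y∈V₂ , refl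
  block⇒goal : ∀ s → StateSet s → block s ≡ goalBlock → GoalSet s
  block⇒goal (zero , y ∷ []) _ eq = ⊥-elim (start-not-goal y eq)
  block⇒goal (suc zero , _) y∈V₂ _ = there here , y∈V₂

-- Only (q₀, 1) has a discrete transition, and it is alone in its block, so an
-- equivalent state takes the very same transition.
disc-source : ∀ s a s' → Disc s a s' → s ≡ guardState
disc-source (q , y ∷ []) a (q' , y' ∷ []) (zero , refl , _ , _ , refl , _) = refl

disc-clause : ∀ s₁ s₁' s₂ a → s₁ ~ s₁' → Disc s₁ a s₂ →
  Σ Pair λ s₂' → Disc s₁' a s₂' × (s₂' ~ s₂)
disc-clause s₁ s₁' s₂ a s₁~s₁' d =
  s₂ , subst (λ s → Disc s a s₂) s₁≡s₁' d , same-class-equiv s₂ s₂ s₂-ok s₂-ok refl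
  where
  s₁≡s₁' : s₁ ≡ s₁'
  s₁≡s₁' = sym (guard-alone s₁ s₁' s₁~s₁' (disc-source s₁ a s₂ d))
  s₂-ok : StateSet s₂
  s₂-ok = disc-target s₁ a s₂ d

ReachesBlockOf : Pair → Pair → Set
ReachesBlockOf s s₂ = Σ ℤ λ τ → Σ Pair λ s' → (0ᴹ ≤ᴹ τ) × Delay s τ s' × (s' ~ s₂)

reaches-block : ∀ {s s'} s₂ → s ⇝ s' → s' ~ s₂ → ReachesBlockOf s s₂
reaches-block _ (τ , 0≤τ , d) s'~s₂ = τ , _ , 0≤τ , d , s'~s₂

-- A delay from s₁ stays at its location.  If it stays in the block of s₁, the
-- equivalent state idles; if it enters the guard block, the equivalent state
-- drains to (q₀, 1); if s₁ is (q₀, 1) itself, the equivalent state is s₁.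
delay-clause : ∀ s₁ s₁' s₂ τ → s₁ ~ s₁' → 0ᴹ ≤ᴹ τ → Delay s₁ τ s₂ → ReachesBlockOf s₁' s₂
delay-clause s₁ s₁'@(q' , _ ∷ []) s₂ τ s₁~s₁' 0≤τ d =
  respond (same-location-blocks s₁ s₂ s₁→s₂)
  where
  s₁→s₂ : proj₁ s₁ ≡ proj₁ s₂
  s₁→s₂ = delay-location s₁ τ s₂ d
  s₂-ok : StateSet s₂
  s₂-ok = delay-target s₁ τ s₂ d
  s₁-ok : StateSet s₁
  s₁-ok = proj₁ (equiv-same-class s₁ s₁' s₁~s₁')
  s₁'-ok : StateSet s₁'
  s₁'-ok = proj₁ (proj₂ (equiv-same-class s₁ s₁' s₁~s₁'))
  same : block s₁ ≡ block s₁'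
  same = proj₂ (proj₂ (equiv-same-class s₁ s₁' s₁~s₁'))

  respond : (block s₂ ≡ block s₁) ⊎ ((block s₁ ≡ guardBlock) ⊎ (block s₂ ≡ guardBlock)) →
    ReachesBlockOf s₁' s₂
  respond (inj₁ stays) =
    reaches-block s₂ (idle q' s₁'-ok)
      (same-class-equiv s₁' s₂ s₁'-ok s₂-ok (trans (sym same) (sym stays)))
  respond (inj₂ (inj₁ guard₁)) =
    reaches-block s₂ (τ , 0≤τ , subst (λ s → Delay s τ s₂) s₁≡s₁' d)
      (same-class-equiv s₂ s₂ s₂-ok s₂-ok refl)
    where
    s₁≡s₁' : s₁ ≡ s₁'
    s₁≡s₁' = sym (guard-alone s₁ s₁' s₁~s₁' (guard-singleton s₁ s₁-ok guard₁))
  respond (inj₂ (inj₂ guard₂)) =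
    reaches-block s₂ (reach-guard q' s₁'-ok)
      (subst (λ q → (q , + 1 ∷ []) ~ s₂) (sym q'≡q₀)
        (same-class-equiv guardState s₂ (inj₁ refl) s₂-ok (sym guard₂)))
    where
    q'≡q₀ : q' ≡ zero
    q'≡q₀ = trans (same-block-location s₁' s₁ (sym same))
                  (trans s₁→s₂ (same-block-location s₂ guardState guard₂))

bisimulation : IsTimeAbstractBisimulation _~_
bisimulation = disc-clause , delay-clause

wait-then-fire : Strategy
wait-then-fire = record { σ = σ ; σ-ok = σ-ok }
  where
  σ : RawRun → Maybe (ℤ × Fin 1)
  σ ((q , x ∷ [] , t , _) , []) with (q Fin.≟ zero) ×-dec ((x ℤ.≟ + 2) ×-dec (t ℤ.≟ + 1))
  ... | yes _ = just (+ 1 , zero)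
  ... | no _ = nothing
  σ (_ , _ ∷ _) = nothing

  -- From the extended state (q₀, 2, 1, 2), delaying by 1 reaches y = 1 and
  -- firing leads to (q₁, 2, 2, 1).
  σ-ok : ∀ e₀ steps τ c → IsFiniteRun (e₀ , steps) → σ (e₀ , steps) ≡ just (τ , c) →
         (0ᴹ ≤ᴹ τ) × Enabled (lastState e₀ steps) (τ , inj₁ c)
  σ-ok (q , x ∷ [] , t , y) [] τ c (e₀-ok , _) eq
    with (q Fin.≟ zero) ×-dec ((x ℤ.≟ + 2) ×-dec (t ℤ.≟ + 1))
  σ-ok (_ , _ ∷ [] , _ , _) [] _ zero (e₀-ok , _) refl | yes (refl , refl , refl) =
    +≤+ z≤n , (suc zero , + 2 ∷ [] , + 2 , + 1 ∷ []) ,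
    +≤+ z≤n , e₀-ok , inj₂ (inj₂ refl) , (+ 1 ∷ []) , refl ,
    (zero , refl , refl , refl , refl , refl , refl) , inj₂ refl , inj₂ (inj₂ refl) , refl
  σ-ok (_ , _ ∷ [] , _ , _) [] _ _ _ () | no _
  σ-ok (_ , _ ∷ [] , _ , _) (_ ∷ _) _ _ _ ()

shows-2 : ∀ {x t} → V₁ℤ (x ∷ []) → Vℤ t → γℤ zero (x ∷ []) t ≡ + 2 ∷ [] → (x ≡ + 2) × (t ≡ + 1)
shows-2 (inj₁ refl) _ ()
shows-2 (inj₂ refl) (inj₁ refl) ()
shows-2 (inj₂ refl) (inj₂ (inj₁ refl)) refl = refl , refl
shows-2 (inj₂ refl) (inj₂ (inj₂ refl)) ()

fire-enters-goal : TransitionsEnterGoal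
fire-enters-goal zero = there here

-- (q₀, 2) is winning: wait-then-fire moves at the start, and every move wins.
winning-at-2 : WinningSet (zero , + 2 ∷ [])
winning-at-2 = inj₂ (inj₁ refl) , wait-then-fire , wins
  where
  wins : WinningFrom wait-then-fire (zero , + 2 ∷ [])
  wins (x ∷ []) t x∈V₁ t∈V γ≡2 r st₀ _ maximal with shows-2 x∈V₁ t∈V γ≡2
  ... | refl , refl =
    won-after-first-step fire-enters-goal r (maximal-moves wait-then-fire r maximal moves)
    where
    moves : Strategy.σ wait-then-fire (Run.prefix r 0) ≢ nothing
    moves = subst (λ e → Strategy.σ wait-then-fire (e , []) ≢ nothing) (sym st₀) (λ ())

-- (q₀, 3) is losing: on the trajectory x = 0 the value stays 3, so the guard
-- y = 1 is never met, and q₀ is not a goal.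
losing-at-3 : ¬ WinningSet (zero , + 3 ∷ [])
losing-at-3 =
  stuck-losing (inj₁ zero) {x = + 0 ∷ []} {t = + 0} (inj₁ refl , inj₁ refl , refl) stuck λ ()
  where
  stuck : Stuck (zero , + 0 ∷ [] , + 0 , + 3 ∷ [])
  stuck τ c (_ , _ , _ , _ , _ , refl , (zero , _ , _ , _ , () , _) , _)

-- (q₀, 2) and (q₀, 3) share a block, but only one of them is winning.
winning-not-union : ¬ UnionOfPieces partition WinningSet
winning-not-union union =
  losing-at-3 (union-respects-equiv partition union 2~3 winning-at-2)
  where
  2~3 : (zero , + 2 ∷ []) ~ (zero , + 3 ∷ [])
  2~3 = same-class-equiv _ _ (inj₂ (inj₁ refl)) (inj₂ (inj₂ refl)) refl

proposition3p19 : Σ Expansion λ 𝓜 → Σ (Domains 𝓜) λ D → Σ (GameRec.Game 𝓜 D) λ A →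
    Σ (Partition (GameSem.StateSet A)) λ P →
    UnionOfPieces P (GameSem.GoalSet A) ×
    GameSem.IsTimeAbstractBisimulation A (InducedEquiv P) ×
    ¬ UnionOfPieces P (GameSem.WinningSet A)
proposition3p19 = 𝓜ℤ , Dℤ , game , partition , goal-union , bisimulation , winning-not-union
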